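{- Let $n\ge 1$, let $p_1,\dots,p_n$ be positive integers and $M=\{1^{p_1},2^{p_2},\dots,n^{p_n}\}$. The map $T\mapsto \widehat{T}$ (defined in the context) is a bijection from $\mathcal{T}_M$ to $\mathcal{T}_M$, and for every $T\in\mathcal{T}_M$ and every integer $q\ge 0$, $$\mathsf{deg}_q(T)=\begin{cases}\mathsf{od}_{q-1}(\widehat{T}) & \text{if } q\ge 1,\\ \mathsf{el}(\widehat{T}) & \text{if } q=0.\end{cases}$$
   Context: A plane tree is a rooted tree in which the children of every node are linearly ordered (drawn left to right). For the multiset $M=\{1^{p_1},\dots,n^{p_n}\}$ with $p=p_1+\cdots+p_n$, a weakly increasing tree on $M$ is a plane tree with $p+1$ nodes labeled by the elements of the multiset $M\cup\{0\}$ (each label used exactly with its multiplicity) such that the labels weakly increase along every path from the root to a leaf, and for every node the labels of its children weakly increase from left to right (so the root is labeled $0$). $\mathcal{T}_M$ denotes the set of weakly increasing trees on $M$. The degree of a node is its number of children; the level of a node is the number of edges on the path from the root to it (the root has level $0$). For a tree $T$: $\mathsf{deg}_q(T)$ is the number of nodes of degree $q$; $\mathsf{od}_q(T)$ is the number of nodes of degree $q$ lying on odd levels; $\mathsf{el}(T)$ is the number of nodes lying on even levels. The map $T\mapsto\widehat T$ is defined recursively on labeled plane trees whose labels weakly increase along root-to-leaf paths and among siblings from left to right: if $T$ is a single node, $\widehat T=T$. Otherwise let $r$ be the label of the root, let $v$ be the leftmost child of the root and $c$ its label, let $H$ be the subtree consisting of $v$ and all its descendants, and let $u_1,\dots,u_s$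 be the other children of the root from left to right, with $T_{u_i}$ the subtree consisting of $u_i$ and its descendants. Then $\widehat T$ is obtained by taking $\widehat H$ (whose root is labeled $c$), changing the label of its root to $r$, attaching a new node labeled $c$ as the leftmost child of this root, and attaching $\widehat{T_{u_1}},\dots,\widehat{T_{u_s}}$ as the subtrees of this new node $c$, from left to right (these being all the children of the new node). -}

module Defs where

open import Data.Nat using (ℕ; zero; suc; _+_; _≤_; _≡ᵇ_)
open import Data.Bool using (Bool; true; false; if_then_else_; not)
open import Data.List using (List; []; _∷_; _++_; length; map; concatMap; replicate)
open import Data.List.Relation.Unary.All using (All)
open import Data.List.Relation.Unary.Linked using (Linked)
open import Data.List.Relation.Binary.Permutation.Propositional using (_↭_)
open import Data.Fin using (Fin; toℕ)
open import Data.List using (allFin)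
open import Data.Product using (_×_)
open import Data.Unit using (⊤)
open import Relation.Binary.PropositionalEquality using (_≡_)

data Tree : Set where
  node : ℕ → List Tree → Tree

label : Tree → ℕ
label (node r _) = r

children : Tree → List Tree
children (node _ ts) = ts

mutual
  labels : Tree → List ℕ
  labels (node r ts) = r ∷ labelsL ts

  labelsL : List Tree → List ℕ
  labelsL [] = []
  labelsL (t ∷ ts) = labels t ++ labelsL ts

mutual
  WeaklyIncreasing : Tree → Set
  WeaklyIncreasing (node r ts) =
    All (λ t → r ≤ label t) ts × Linked _≤_ (map label ts) × WeaklyIncreasingL ts

  WeaklyIncreasingL : List Tree → Set
  WeaklyIncreasingL [] = ⊤
  WeaklyIncreasingL (t ∷ ts) = WeaklyIncreasing t × WeaklyIncreasingL ts

-- the multiset M = {1^{p_1}, ..., n^{p_n}} as a list (label i+1 for i : Fin n)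
multiset : (n : ℕ) → (Fin n → ℕ) → List ℕ
multiset n p = concatMap (λ i → replicate (p i) (suc (toℕ i))) (allFin n)

-- T ∈ 𝒯_M : weakly increasing plane tree, root labelled 0, label multiset M ∪ {0}
InTM : (n : ℕ) → (Fin n → ℕ) → Tree → Set
InTM n p T = WeaklyIncreasing T × label T ≡ 0 × labels T ↭ (0 ∷ multiset n p)

mutual
  hat : Tree → Tree
  hat (node r []) = node r []
  hat (node r (h@(node c hs) ∷ us)) = node r (node c (hatL us) ∷ children (hat h))

  hatL : List Tree → List Tree
  hatL [] = []
  hatL (t ∷ ts) = hat t ∷ hatL ts

mutual
  deg : ℕ → Tree → ℕ
  deg q (node r ts) = (if length ts ≡ᵇ q then 1 else 0) + degL q ts

  degL : ℕ → List Tree → ℕ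
  degL q [] = 0
  degL q (t ∷ ts) = deg q t + degL q ts

-- odAt b q T: number of nodes of degree q on odd levels of T, where the root
-- of T is on an odd level iff b = true
mutual
  odAt : Bool → ℕ → Tree → ℕ
  odAt b q (node r ts) = (if b then (if length ts ≡ᵇ q then 1 else 0) else 0) + odAtL (not b) q ts

  odAtL : Bool → ℕ → List Tree → ℕ
  odAtL b q [] = 0
  odAtL b q (t ∷ ts) = odAt b q t + odAtL b q ts

od : ℕ → Tree → ℕ
od q T = odAt false q T

-- elAt b T: number of nodes on even levels, root on an odd level iff b = true
mutual
  elAt : Bool → Tree → ℕ
  elAt b (node r ts) = (if b then 0 else 1) + elAtL (not b) ts

  elAtL : Bool → List Tree → ℕ
  elAtL b [] = 0
  elAtL b (t ∷ ts) = elAt b t + elAtL b ts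

el : Tree → ℕ
el T = elAt false T

module Submission where

-- hat is invertible on all plane trees (unhat undoes it clause by clause) and
-- preserves the root label, the label multiset and weak increase in both
-- directions, hence restricts to a bijection of 𝒯_M.  In hat (node r (v ∷ us))
-- the only new node is the child c carrying hatL us: it has one child fewer than
-- the old root and lies at depth one, the subtrees hatL us hang at depth two, and
-- the children of hat v keep their depth.  By induction every node of T of
-- degree q + 1 becomes a node of degree q on an odd level of T̂, and the nodes on
-- even levels of T̂ correspond to the leaves of T.

open import Defs
open import Data.Bool using (true; false; if_then_else_)
open import Data.Fin using (Fin)
open import Data.List using (List; []; _∷_; map; length)
open import Data.List.Relation.Unary.All using (_∷_)
import Data.List.Relation.Unary.All as All
open import Data.List.Relation.Unary.All.Properties using (map⁻)
open import Data.List.Relation.Unary.Linked using (Linked; [-]; _∷_)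
import Data.List.Relation.Unary.Linked as Linked
open import Data.List.Relation.Unary.Linked.Properties using (Linked⇒All)
open import Data.List.Relation.Binary.Permutation.Propositional
  using (_↭_; prep; ↭-refl; ↭-sym; ↭-trans)
open import Data.List.Relation.Binary.Permutation.Propositional.Properties
  using (++⁺; ++-comm)
open import Data.Nat using (ℕ; suc; _+_; _≤_; _≡ᵇ_)
open import Data.Nat.Properties using (≤-refl; ≤-trans; +-comm; +-assoc)
open import Data.Product using (_×_; Σ; _,_; proj₁; proj₂)
open import Relation.Binary.PropositionalEquality
  using (_≡_; refl; sym; trans; cong; cong₂; subst; module ≡-Reasoning)

label-hat : ∀ t → label (hat t) ≡ label t
label-hat (node r []) = refl
label-hat (node r (node c hs ∷ us)) = refl

length-hatL : ∀ ts → length (hatL ts) ≡ length ts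
length-hatL [] = refl
length-hatL (t ∷ ts) = cong suc (length-hatL ts)

map-label-hatL : ∀ ts → map label (hatL ts) ≡ map label ts
map-label-hatL [] = refl
map-label-hatL (t ∷ ts) = cong₂ _∷_ (label-hat t) (map-label-hatL ts)

hat-∷ : ∀ r t us → hat (node r (t ∷ us)) ≡ node r (node (label t) (hatL us) ∷ children (hat t))
hat-∷ r (node c hs) us = refl

-- unhatNode r ts is unhat (node r ts); splitting off the root keeps the
-- recursion structural.
mutual
  unhat : Tree → Tree
  unhat (node r ts) = unhatNode r ts

  unhatNode : ℕ → List Tree → Tree
  unhatNode r [] = node r []
  unhatNode r (node c vs ∷ ws) = node r (unhatNode c ws ∷ unhatL vs)

  unhatL : List Tree → List Tree
  unhatL [] = []
  unhatL (t ∷ ts) = unhat t ∷ unhatL ts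

label-unhatNode : ∀ r ts → label (unhatNode r ts) ≡ r
label-unhatNode r [] = refl
label-unhatNode r (node c vs ∷ ws) = refl

mutual
  hat-unhatNode : ∀ r ts → hat (unhatNode r ts) ≡ node r ts
  hat-unhatNode r [] = refl
  hat-unhatNode r (node c vs ∷ ws)
    rewrite hat-∷ r (unhatNode c ws) (unhatL vs)
          | label-unhatNode c ws
          | hatL-unhatL vs
          | hat-unhatNode c ws = refl

  hatL-unhatL : ∀ ts → hatL (unhatL ts) ≡ ts
  hatL-unhatL [] = refl
  hatL-unhatL (node r ts ∷ us) = cong₂ _∷_ (hat-unhatNode r ts) (hatL-unhatL us)

hat-unhat : ∀ t → hat (unhat t) ≡ t
hat-unhat (node r ts) = hat-unhatNode r ts

unhat-η : ∀ t → unhatNode (label t) (children t) ≡ unhat t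
unhat-η (node r ts) = refl

mutual
  unhat-hat : ∀ t → unhat (hat t) ≡ t
  unhat-hat (node r []) = refl
  unhat-hat (node r (h@(node c hs) ∷ us)) =
    cong₂ (λ v vs → node r (v ∷ vs)) (unhatNode-children-hat h) (unhatL-hatL us)

  unhatNode-children-hat : ∀ t → unhatNode (label t) (children (hat t)) ≡ t
  unhatNode-children-hat t = begin
    unhatNode (label t) (children (hat t))        ≡⟨ cong (λ x → unhatNode x (children (hat t))) (sym (label-hat t)) ⟩
    unhatNode (label (hat t)) (children (hat t))  ≡⟨ unhat-η (hat t) ⟩
    unhat (hat t)                                 ≡⟨ unhat-hat t ⟩
    t                                             ∎
    where open ≡-Reasoning

  unhatL-hatL : ∀ ts → unhatL (hatL ts) ≡ ts
  unhatL-hatL [] = refl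
  unhatL-hatL (t ∷ ts) = cong₂ _∷_ (unhat-hat t) (unhatL-hatL ts)

hat-injective : ∀ {t u} → hat t ≡ hat u → t ≡ u
hat-injective {t} {u} eq = trans (sym (unhat-hat t)) (trans (cong unhat eq) (unhat-hat u))

mutual
  labels-hat : ∀ t → labels (hat t) ↭ labels t
  labels-hat (node r []) = ↭-refl
  labels-hat (node r (h@(node c hs) ∷ us)) = prep r (labelsL-children-hat (node r (h ∷ us)))

  labelsL-children-hat : ∀ t → labelsL (children (hat t)) ↭ labelsL (children t)
  labelsL-children-hat (node r []) = ↭-refl
  labelsL-children-hat (node r (h@(node c hs) ∷ us)) =
    prep c (↭-trans (++⁺ (labelsL-hatL us) (labelsL-children-hat h)) (++-comm (labelsL us) (labelsL hs)))

  labelsL-hatL : ∀ ts → labelsL (hatL ts) ↭ labelsL ts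
  labelsL-hatL [] = ↭-refl
  labelsL-hatL (t ∷ ts) = ++⁺ (labels-hat t) (labelsL-hatL ts)

weaklyIncreasing⁻ : ∀ t → WeaklyIncreasing t →
  Linked _≤_ (label t ∷ map label (children t)) × WeaklyIncreasingL (children t)
weaklyIncreasing⁻ (node r []) (_ , _ , w) = [-] , w
weaklyIncreasing⁻ (node r (t ∷ ts)) (r≤t ∷ _ , sorted , w) = r≤t ∷ sorted , w

weaklyIncreasing⁺ : ∀ t →
  Linked _≤_ (label t ∷ map label (children t)) × WeaklyIncreasingL (children t) →
  WeaklyIncreasing t
weaklyIncreasing⁺ (node r ts) (sorted , w) =
  map⁻ (All.tail (Linked⇒All ≤-trans ≤-refl sorted)) , Linked.tail sorted , w

mutual
  hat-weaklyIncreasing : ∀ t → WeaklyIncreasing t → WeaklyIncreasing (hat t)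
  hat-weaklyIncreasing (node r []) w = w
  hat-weaklyIncreasing (node r (h@(node c hs) ∷ us)) w@(_ , _ , wh , wus)
    with weaklyIncreasing⁻ (hat h) (hat-weaklyIncreasing h wh)
  ... | sorted-hh , whh =
    weaklyIncreasing⁺ (hat (node r (h ∷ us)))
      ( Linked.head sorted-us
          ∷ subst (λ x → Linked _≤_ (x ∷ map label (children (hat h)))) (label-hat h) sorted-hh
      , weaklyIncreasing⁺ (node c (hatL us))
          ( subst (λ xs → Linked _≤_ (c ∷ xs)) (sym (map-label-hatL us)) (Linked.tail sorted-us)
          , hatL-weaklyIncreasingL us wus)
      , whh)
    where
    sorted-us : Linked _≤_ (r ∷ c ∷ map label us)
    sorted-us = proj₁ (weaklyIncreasing⁻ (node r (h ∷ us)) w)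

  hatL-weaklyIncreasingL : ∀ ts → WeaklyIncreasingL ts → WeaklyIncreasingL (hatL ts)
  hatL-weaklyIncreasingL [] w = w
  hatL-weaklyIncreasingL (t ∷ ts) (wt , wts) = hat-weaklyIncreasing t wt , hatL-weaklyIncreasingL ts wts

mutual
  hat-weaklyIncreasing⁻ : ∀ t → WeaklyIncreasing (hat t) → WeaklyIncreasing t
  hat-weaklyIncreasing⁻ (node r []) w = w
  hat-weaklyIncreasing⁻ (node r (h@(node c hs) ∷ us)) w@(_ , _ , wc , whh) =
    weaklyIncreasing⁺ (node r (h ∷ us))
      ( Linked.head sorted-hh
          ∷ subst (λ xs → Linked _≤_ (c ∷ xs)) (map-label-hatL us) (proj₁ (weaklyIncreasing⁻ _ wc))
      , hat-weaklyIncreasing⁻ h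
          (weaklyIncreasing⁺ (hat h)
            ( subst (λ x → Linked _≤_ (x ∷ map label (children (hat h)))) (sym (label-hat h))
                (Linked.tail sorted-hh)
            , whh))
      , hatL-weaklyIncreasingL⁻ us (proj₂ (weaklyIncreasing⁻ _ wc)))
    where
    sorted-hh : Linked _≤_ (r ∷ c ∷ map label (children (hat h)))
    sorted-hh = proj₁ (weaklyIncreasing⁻ (hat (node r (h ∷ us))) w)

  hatL-weaklyIncreasingL⁻ : ∀ ts → WeaklyIncreasingL (hatL ts) → WeaklyIncreasingL ts
  hatL-weaklyIncreasingL⁻ [] w = w
  hatL-weaklyIncreasingL⁻ (t ∷ ts) (wt , wts) = hat-weaklyIncreasing⁻ t wt , hatL-weaklyIncreasingL⁻ ts wts

hat-InTM : ∀ n p T → InTM n p T → InTM n p (hat T)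
hat-InTM n p T (w , root , perm) =
  hat-weaklyIncreasing T w , trans (label-hat T) root , ↭-trans (labels-hat T) perm

hat-InTM⁻ : ∀ n p T → InTM n p (hat T) → InTM n p T
hat-InTM⁻ n p T (w , root , perm) =
  hat-weaklyIncreasing⁻ T w , trans (sym (label-hat T)) root , ↭-trans (↭-sym (labels-hat T)) perm

od-η : ∀ q t → od q t ≡ odAtL true q (children t)
od-η q (node r ts) = refl

el-η : ∀ t → el t ≡ suc (elAtL true (children t))
el-η (node r ts) = refl

mutual
  deg-suc-hat : ∀ q t → deg (suc q) t ≡ od q (hat t)
  deg-suc-hat q (node r []) = refl
  deg-suc-hat q (node r (h@(node c hs) ∷ us)) = begin
    hasDegree (length us) + (deg (suc q) h + degL (suc q) us)
      ≡⟨ cong₂ (λ x y → hasDegree (length us) + (x + y)) (trans (deg-suc-hat q h) (od-η q (hat h))) (degL-suc-hatL q us) ⟩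
    hasDegree (length us) + (oddH + oddUs)
      ≡⟨ cong (hasDegree (length us) +_) (+-comm oddH oddUs) ⟩
    hasDegree (length us) + (oddUs + oddH)
      ≡⟨ sym (+-assoc (hasDegree (length us)) oddUs oddH) ⟩
    hasDegree (length us) + oddUs + oddH
      ≡⟨ cong (λ k → hasDegree k + oddUs + oddH) (sym (length-hatL us)) ⟩
    hasDegree (length (hatL us)) + oddUs + oddH
      ∎
    where
    open ≡-Reasoning
    hasDegree : ℕ → ℕ
    hasDegree k = if k ≡ᵇ q then 1 else 0
    oddH oddUs : ℕ
    oddH = odAtL true q (children (hat h))
    oddUs = odAtL false q (hatL us)

  degL-suc-hatL : ∀ q ts → degL (suc q) ts ≡ odAtL false q (hatL ts)
  degL-suc-hatL q [] = refl
  degL-suc-hatL q (t ∷ ts) = cong₂ _+_ (deg-suc-hat q t) (degL-suc-hatL q ts)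

mutual
  deg-zero-hat : ∀ t → deg 0 t ≡ el (hat t)
  deg-zero-hat (node r []) = refl
  deg-zero-hat (node r (h@(node c hs) ∷ us)) = begin
    deg 0 h + degL 0 us          ≡⟨ cong₂ _+_ (trans (deg-zero-hat h) (el-η (hat h))) (degL-zero-hatL us) ⟩
    suc (evenH + evenUs)         ≡⟨ cong suc (+-comm evenH evenUs) ⟩
    suc (evenUs + evenH)         ∎
    where
    open ≡-Reasoning
    evenH evenUs : ℕ
    evenH = elAtL true (children (hat h))
    evenUs = elAtL false (hatL us)

  degL-zero-hatL : ∀ ts → degL 0 ts ≡ elAtL false (hatL ts)
  degL-zero-hatL [] = refl
  degL-zero-hatL (t ∷ ts) = cong₂ _+_ (deg-zero-hat t) (degL-zero-hatL ts)

theorem1p2 : (n : ℕ) → 1 ≤ n → (p : Fin n → ℕ) → (∀ i → 1 ≤ p i) →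
    ((T : Tree) → InTM n p T → InTM n p (hat T))
    × ((T U : Tree) → InTM n p T → InTM n p U → hat T ≡ hat U → T ≡ U)
    × ((U : Tree) → InTM n p U → Σ Tree (λ T → InTM n p T × hat T ≡ U))
    × ((T : Tree) → InTM n p T →
         ((q : ℕ) → deg (suc q) T ≡ od q (hat T)) × (deg 0 T ≡ el (hat T)))
theorem1p2 n _ p _ =
    hat-InTM n p
  , (λ T U _ _ → hat-injective)
  , (λ U U∈𝒯 → unhat U
               , hat-InTM⁻ n p (unhat U) (subst (InTM n p) (sym (hat-unhat U)) U∈𝒯)
               , hat-unhat U)
  , (λ T _ → (λ q → deg-suc-hat q T) , deg-zero-hat T)
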